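{- Let $\alpha=\frac{1+\sqrt5}{2}$, $\beta=\frac{1-\sqrt5}{2}$, and let $x$ be a positive integer. The numbers $\frac{\alpha}{\beta}$ and $\frac{\beta^x+1}{\alpha^x+1}$ are multiplicatively dependent if and only if $x=1$, $x=3$, or $x$ is even.
   Context: Two nonzero algebraic numbers $\gamma_1,\gamma_2$ are multiplicatively dependent if there exist integers $k,l$, not both zero, with $\gamma_1^k\gamma_2^l=1$. -}

module Defs where

open import Data.Nat as ℕ using (ℕ; zero; suc)
open import Data.Integer as ℤ using (ℤ; +_; -[1+_])
open import Data.Rational as ℚ using (ℚ; 0ℚ; 1ℚ; ½; ≢-nonZero)
open import Data.Rational.Properties using (_≟_)
open import Data.Product using (∃₂; _×_)
open import Relation.Nullary using (¬_; yes; no)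
open import Relation.Binary.PropositionalEquality using (_≡_)

-- The quadratic field Q(√5): an element a + b√5 is represented by the
-- pair (a , b) of rationals.  Since ℚ is normalised, _≡_ on Q5 is the
-- field equality.
record Q5 : Set where
  constructor q5
  field
    re : ℚ
    im : ℚ
open Q5 public

five : ℚ
five = (+ 5) ℚ./ 1

0q : Q5
0q = q5 0ℚ 0ℚ

1q : Q5
1q = q5 1ℚ 0ℚ

infixl 6 _⊕_
infixl 7 _⊗_ _⊘_

_⊕_ : Q5 → Q5 → Q5
q5 a b ⊕ q5 c d = q5 (a ℚ.+ c) (b ℚ.+ d)

-- (a + b√5)(c + d√5) = (ac + 5bd) + (ad + bc)√5
_⊗_ : Q5 → Q5 → Q5
q5 a b ⊗ q5 c d =
  q5 (a ℚ.* c ℚ.+ five ℚ.* (b ℚ.* d)) (a ℚ.* d ℚ.+ b ℚ.* c)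

-- field norm N(a + b√5) = a² - 5b²  (zero iff a + b√5 = 0)
norm : Q5 → ℚ
norm (q5 a b) = a ℚ.* a ℚ.- five ℚ.* (b ℚ.* b)

-- multiplicative inverse (a - b√5)/N; junk value 0 at 0 (never used on 0 below)
inv : Q5 → Q5
inv (q5 a b) with norm (q5 a b) ≟ 0ℚ
... | yes _ = 0q
... | no n≢0 = q5 (ℚ._÷_ a n {{≢-nonZero n≢0}}) (ℚ._÷_ (ℚ.- b) n {{≢-nonZero n≢0}})
  where n = norm (q5 a b)

_⊘_ : Q5 → Q5 → Q5
x ⊘ y = x ⊗ inv y

_^ℕ_ : Q5 → ℕ → Q5
x ^ℕ zero = 1q
x ^ℕ suc n = x ⊗ (x ^ℕ n)

_^ℤ_ : Q5 → ℤ → Q5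
x ^ℤ (+ n) = x ^ℕ n
x ^ℤ -[1+ n ] = inv (x ^ℕ suc n)

α : Q5
α = q5 ½ ½

β : Q5
β = q5 ½ (ℚ.- ½)

MultDep : Q5 → Q5 → Set
MultDep γ₁ γ₂ =
  ∃₂ λ (k l : ℤ) → ¬ (k ≡ + 0 × l ≡ + 0) × ((γ₁ ^ℤ k) ⊗ (γ₂ ^ℤ l) ≡ 1q)

-- Write U = 1 + √5, so that α = U/2, β = Ū/2, α/β = W/4 with W = -U², and
-- α^x + 1 = V/2^x, β^x + 1 = V̄/2^x with V = U^x + 2^x: everything lives in ℤ[√5][½].
-- For even x, αβ = -1 gives (α/β)^x ((β^x + 1)/(α^x + 1))² = 1, and x = 1, 3 are
-- settled by computation. For odd x ≥ 5 let e = re(U^x) and t = 2^x. As N(U^x) = -t²,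
-- V V̄ = 2te and V² ≡ 2t V (mod e). A multiplicative relation, cleared of denominators,
-- reads W^p V̄^(l+1) 2^a = W^q V^(l+1) 2^b; multiplying by V and reducing modulo e
-- shows that e divides a power of 2 times V, hence (rational parts) a power of 2.
-- But 2e = 2^x L_x with L_x a Lucas number ≥ 11 never divisible by 8. The relations
-- (α/β)^n = 1 are excluded since (α/β)^n = ±α^(2n) is irrational.
module Submission where

open import Defs
open import Data.Nat using (ℕ; _≤_)
open import Data.Nat.Divisibility using (_∣_)
open import Data.Sum using (_⊎_)
open import Function.Bundles using (_⇔_)
open import Relation.Binary.PropositionalEquality using (_≡_)

open import Algebra.Bundles using (CommutativeMonoid; CommutativeSemiring; Semiring)
open import Data.Empty using (⊥)
open import Data.Integer as ℤ using (ℤ; +_; -[1+_])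
open import Data.List using (List; _∷_; [])
open import Data.List.Membership.Propositional using (_∈_)
open import Data.List.Relation.Unary.All as All using (All; all?)
open import Data.List.Relation.Unary.Any using (here)
open import Data.Nat as ℕ using (zero; suc)
open import Data.Nat.Coprimality using (Coprime; 1-coprimeTo; coprime-+; coprime-divisor)
open import Data.Nat.Divisibility
  using (divides; ∣-trans; ∣1⇒≡1; 1∣_; *-monoʳ-∣; *-cancelˡ-∣; m∣m*n; n∣m*n; ∣m+n∣m⇒∣n; n∣m⇒m%n≡0; ∣⇒≤)
open import Data.Nat.DivMod using (_%_; %-distribˡ-+)
open import Data.Product using (∃-syntax; ∃₂; _×_; _,_; proj₁)
open import Data.Product.Properties using (≡-dec)
open import Data.Rational as ℚ using (ℚ; 0ℚ; 1ℚ; ½)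
open import Data.Rational.Literals using (fromℤ)
open import Data.Sum using (inj₁; inj₂; [_,_]′)
open import Function using (_∘_)
open import Function.Bundles using (mk⇔)
open import Level using (0ℓ; _⊔_)
open import Relation.Binary.Bundles using (Setoid)
open import Relation.Binary.PropositionalEquality
  using (refl; sym; trans; cong; cong₂; subst; subst₂; isEquivalence; module ≡-Reasoning)
open import Relation.Nullary using (¬_; ¬?; yes; no; contradiction)
open import Relation.Nullary.Decidable using (from-yes; from-no)
import Algebra.Definitions.RawSemiring as RawSemiringDefinitions
import Algebra.Properties.CommutativeSemigroup as CommSemigroupProperties
import Algebra.Properties.CommutativeSemiring.Exp as CommSemiringExp
import Data.Integer.Properties as ℤP
import Data.Integer.Solver as ℤ-Solver
import Data.Integer.Tactic.RingSolver as ℤ-Tactic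
import Data.Nat.Properties as ℕP
import Data.Nat.Tactic.RingSolver as ℕ-Tactic
import Data.Rational.Properties as ℚP
import Data.Rational.Solver as ℚ-Solver
import Data.Rational.Unnormalised as ℚᵘ
import Data.Rational.Unnormalised.Properties as ℚᵘP
open import Data.List.Membership.DecPropositional (≡-dec ℕ._≟_ ℕ._≟_) using (_∈?_)
import Relation.Binary.Reasoning.Setoid as SetoidReasoning

module ℚS = ℚ-Solver.+-*-Solver
module ℤS = ℤ-Solver.+-*-Solver

module PowersOfTwo where
  open import Data.Nat using (_+_; _*_; _^_)

  data Parity : ℕ → Set where
    even : ∀ m → Parity (2 * m)
    odd  : ∀ m → Parity (1 + 2 * m)

  parity : ∀ n → Parity n
  parity zero    = even 0
  parity (suc n) with parity n
  ... | even m = odd m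
  ... | odd m  = subst Parity (cong suc (ℕP.+-suc m (m + 0))) (even (suc m))

  odd-coprime-2 : ∀ m → Coprime (1 + 2 * m) 2
  odd-coprime-2 zero    = 1-coprimeTo 2
  odd-coprime-2 (suc m) =
    subst (λ k → Coprime k 2) (cong (suc ∘ suc) (sym (ℕP.+-suc m (m + 0)))) (coprime-+ (odd-coprime-2 m))

  ∣2^⇒∣2^ : ∀ M j {n} → n ∣ 2 ^ M → ¬ 2 ^ suc j ∣ n → n ∣ 2 ^ j
  ∣2^⇒∣2^ zero    j n∣1 _ rewrite ∣1⇒≡1 n∣1 = 1∣ (2 ^ j)
  ∣2^⇒∣2^ (suc M) j {n} n∣2^M 2^j∤n with parity n
  ... | odd m  = ∣2^⇒∣2^ M j (coprime-divisor (odd-coprime-2 m) n∣2^M) 2^j∤n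
  ∣2^⇒∣2^ (suc M) zero    _     2∤n   | even m = contradiction (m∣m*n m) 2∤n
  ∣2^⇒∣2^ (suc M) (suc j) n∣2^M 2^j∤n | even m =
    *-monoʳ-∣ 2 (∣2^⇒∣2^ M j (*-cancelˡ-∣ {m} 2 n∣2^M) (2^j∤n ∘ *-monoʳ-∣ 2))

  IsPowerOf2 : ℕ → Set
  IsPowerOf2 n = ∃[ K ] n ≡ 2 ^ K

  isPowerOf2-* : ∀ {m n} → IsPowerOf2 m → IsPowerOf2 n → IsPowerOf2 (m * n)
  isPowerOf2-* (K , refl) (L , refl) = K + L , sym (ℕP.^-distribˡ-+-* 2 K L)

  isPowerOf2-^ : ∀ {m} → IsPowerOf2 m → ∀ n → IsPowerOf2 (m ^ n)
  isPowerOf2-^ (K , refl) n = K * n , ℕP.^-*-assoc 2 K n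

open PowersOfTwo

-- Lucas numbers

module Lucas where
  open import Data.Nat using (_+_; _*_; _^_)
  open ℕ-Tactic using (solve-∀)
  open ≡-Reasoning

  -- (1 + √5)ⁿ = uRe n + uIm n √5
  uRe uIm : ℕ → ℕ
  uRe zero    = 1
  uRe (suc n) = uRe n + 5 * uIm n
  uIm zero    = 0
  uIm (suc n) = uRe n + uIm n

  uRe≢0 : ∀ n → ¬ uRe n ≡ 0
  uRe≢0 zero    ()
  uRe≢0 (suc n) eq = uRe≢0 n (ℕP.m+n≡0⇒m≡0 (uRe n) eq)

  uIm[1+n]≢0 : ∀ n → ¬ uIm (suc n) ≡ 0
  uIm[1+n]≢0 n = uRe≢0 n ∘ ℕP.m+n≡0⇒m≡0 (uRe n)

  lucas : ℕ → ℕ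
  lucas 0             = 2
  lucas 1             = 1
  lucas (suc (suc n)) = lucas (suc n) + lucas n

  uRe-recurrence : ∀ n → uRe (2 + n) ≡ 2 * uRe (1 + n) + 4 * uRe n
  uRe-recurrence n = identity (uRe n) (uIm n)
    where
    identity : ∀ a b → (a + 5 * b) + 5 * (a + b) ≡ 2 * (a + 5 * b) + 4 * a
    identity = solve-∀

  2*uRe≡2^*lucas : ∀ n → 2 * uRe n ≡ 2 ^ n * lucas n
  2*uRe≡2^*lucas 0             = refl
  2*uRe≡2^*lucas 1             = refl
  2*uRe≡2^*lucas (suc (suc n)) = begin
    2 * uRe (2 + n)                                            ≡⟨ cong (2 *_) (uRe-recurrence n) ⟩
    2 * (2 * uRe (1 + n) + 4 * uRe n)                          ≡⟨ regroup (uRe (1 + n)) (uRe n) ⟩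
    2 * (2 * uRe (1 + n)) + 4 * (2 * uRe n)                    ≡⟨ cong₂ (λ a b → 2 * a + 4 * b)
                                                                        (2*uRe≡2^*lucas (suc n)) (2*uRe≡2^*lucas n) ⟩
    2 * (2 ^ (1 + n) * lucas (1 + n)) + 4 * (2 ^ n * lucas n)  ≡⟨ collect (2 ^ n) (lucas (1 + n)) (lucas n) ⟩
    2 ^ (2 + n) * lucas (2 + n)                                ∎
    where
    regroup : ∀ a b → 2 * (2 * a + 4 * b) ≡ 2 * (2 * a) + 4 * (2 * b)
    regroup = solve-∀
    collect : ∀ p a b → 2 * (2 * p * a) + 4 * (p * b) ≡ 2 * (2 * p) * (a + b)
    collect = solve-∀

  lucasPairs%8 : List (ℕ × ℕ)
  lucasPairs%8 = (2 , 1) ∷ (1 , 3) ∷ (3 , 4) ∷ (4 , 7) ∷ (7 , 3) ∷ (3 , 2)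
               ∷ (2 , 5) ∷ (5 , 7) ∷ (7 , 4) ∷ (4 , 3) ∷ (3 , 7) ∷ (7 , 2) ∷ []

  step%8 : ℕ × ℕ → ℕ × ℕ
  step%8 (a , b) = b , (b + a) % 8

  lucasPairs%8-closed : All (λ p → step%8 p ∈ lucasPairs%8) lucasPairs%8
  lucasPairs%8-closed = from-yes (all? (λ p → step%8 p ∈? lucasPairs%8) lucasPairs%8)

  lucasPairs%8-nonzero : All (λ p → ¬ proj₁ p ≡ 0) lucasPairs%8
  lucasPairs%8-nonzero = from-yes (all? (λ p → ¬? (proj₁ p ℕ.≟ 0)) lucasPairs%8)

  lucas%8∈lucasPairs%8 : ∀ n → (lucas n % 8 , lucas (1 + n) % 8) ∈ lucasPairs%8
  lucas%8∈lucasPairs%8 zero    = here refl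
  lucas%8∈lucasPairs%8 (suc n) =
    subst (_∈ lucasPairs%8)
      (cong (lucas (1 + n) % 8 ,_) (sym (%-distribˡ-+ (lucas (1 + n)) (lucas n) 8)))
      (All.lookup lucasPairs%8-closed (lucas%8∈lucasPairs%8 n))

  8∤lucas : ∀ n → ¬ 8 ∣ lucas n
  8∤lucas n 8∣lucas = All.lookup lucasPairs%8-nonzero (lucas%8∈lucasPairs%8 n) (n∣m⇒m%n≡0 (lucas n) 8 8∣lucas)

  lucas≥11 : ∀ {n} → 5 ≤ n → 11 ≤ lucas n
  lucas≥11 5≤n with ℕP.m≤n⇒∃[o]m+o≡n 5≤n
  ... | k , refl = go k
    where
    go : ∀ k → 11 ≤ lucas (5 + k)
    go zero    = ℕP.≤-refl
    go (suc k) = ℕP.≤-trans (go k) (ℕP.m≤m+n _ _)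

  uRe∤powerOf2 : ∀ {n c} → 5 ≤ n → IsPowerOf2 c → ¬ uRe n ∣ c
  uRe∤powerOf2 {n} 5≤n (K , refl) uRe∣2^K = contradiction (ℕP.≤-trans (lucas≥11 5≤n) lucas≤4) (from-no (11 ℕ.≤? 4))
    where
    lucas∣2^ : lucas n ∣ 2 ^ suc K
    lucas∣2^ = ∣-trans (divides (2 ^ n) (2*uRe≡2^*lucas n)) (*-monoʳ-∣ 2 uRe∣2^K)
    lucas≤4 : lucas n ≤ 4
    lucas≤4 = ∣⇒≤ (∣2^⇒∣2^ (suc K) 2 lucas∣2^ (8∤lucas n))

open Lucas

-- Congruences modulo an element of a commutative semiring

module Congruence {c ℓ} (R : CommutativeSemiring c ℓ) where
  open CommutativeSemiring R renaming (refl to ≈-refl; sym to ≈-sym; trans to ≈-trans)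
  open RawSemiringDefinitions (Semiring.rawSemiring semiring) using (_^_)
  open CommSemigroupProperties *-commutativeSemigroup using (x∙yz≈y∙xz)
  open CommSemigroupProperties +-commutativeSemigroup using (xy∙z≈xz∙y)

  infix 4 _≈_[mod_]
  _≈_[mod_] : Carrier → Carrier → Carrier → Set (c ⊔ ℓ)
  x ≈ y [mod e ] = ∃₂ λ r s → x + e * r ≈ y + e * s

  module _ {e : Carrier} where

    ≈⇒≈[mod] : ∀ {x y} → x ≈ y → x ≈ y [mod e ]
    ≈⇒≈[mod] x≈y = 0# , 0# , +-congʳ x≈y

    ≈[mod]-sym : ∀ {x y} → x ≈ y [mod e ] → y ≈ x [mod e ]
    ≈[mod]-sym (r , s , eq) = s , r , ≈-sym eq

    ≈[mod]-trans : ∀ {x y z} → x ≈ y [mod e ] → y ≈ z [mod e ] → x ≈ z [mod e ]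
    ≈[mod]-trans {x} {y} {z} (r , s , x≈y) (r′ , s′ , y≈z) = r + r′ , s′ + s , (begin
      x + e * (r + r′)          ≈⟨ split x r r′ ⟩
      (x + e * r) + e * r′      ≈⟨ +-congʳ x≈y ⟩
      (y + e * s) + e * r′      ≈⟨ xy∙z≈xz∙y y (e * s) (e * r′) ⟩
      (y + e * r′) + e * s      ≈⟨ +-congʳ y≈z ⟩
      (z + e * s′) + e * s      ≈⟨ split z s′ s ⟨
      z + e * (s′ + s)          ∎)
      where
      open SetoidReasoning setoid
      split : ∀ x r r′ → x + e * (r + r′) ≈ (x + e * r) + e * r′
      split x r r′ = ≈-trans (+-congˡ (distribˡ e r r′)) (≈-sym (+-assoc x (e * r) (e * r′)))

    ≈[mod]-*-congˡ : ∀ z {x y} → x ≈ y [mod e ] → z * x ≈ z * y [mod e ]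
    ≈[mod]-*-congˡ z {x} {y} (r , s , x≈y) = z * r , z * s , (begin
      z * x + e * (z * r)       ≈⟨ +-congˡ (x∙yz≈y∙xz z e r) ⟨
      z * x + z * (e * r)       ≈⟨ distribˡ z x (e * r) ⟨
      z * (x + e * r)           ≈⟨ *-congˡ x≈y ⟩
      z * (y + e * s)           ≈⟨ distribˡ z y (e * s) ⟩
      z * y + z * (e * s)       ≈⟨ +-congˡ (x∙yz≈y∙xz z e s) ⟩
      z * y + e * (z * s)       ∎)
      where open SetoidReasoning setoid

  ≈[mod]-setoid : Carrier → Setoid c (c ⊔ ℓ)
  ≈[mod]-setoid e = record
    { _≈_           = _≈_[mod e ]
    ; isEquivalence = record { refl = ≈⇒≈[mod] ≈-refl ; sym = ≈[mod]-sym ; trans = ≈[mod]-trans }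
    }

  ≈[mod]-*-congʳ : ∀ {e} z {x y} → x ≈ y [mod e ] → x * z ≈ y * z [mod e ]
  ≈[mod]-*-congʳ {e} z {x} {y} x≈y = begin
    x * z   ≈⟨ ≈⇒≈[mod] (*-comm x z) ⟩
    z * x   ≈⟨ ≈[mod]-*-congˡ z x≈y ⟩
    z * y   ≈⟨ ≈⇒≈[mod] (*-comm z y) ⟩
    y * z   ∎
    where open SetoidReasoning (≈[mod]-setoid e)

  *≈0[mod] : ∀ e s → e * s ≈ 0# [mod e ]
  *≈0[mod] e s = 0# , s , ≈-trans (+-congˡ (zeroʳ e)) (≈-trans (+-identityʳ (e * s)) (≈-sym (+-identityˡ (e * s))))

  ^suc≈[mod] : ∀ {e v m} → v * v ≈ m * v [mod e ] → ∀ n → v ^ suc n ≈ m ^ n * v [mod e ]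
  ^suc≈[mod] {e} {v} {m} v²≈mv zero    = ≈⇒≈[mod] (*-comm v 1#)
  ^suc≈[mod] {e} {v} {m} v²≈mv (suc n) = begin
    v * v ^ suc n       ≈⟨ ≈[mod]-*-congˡ v (^suc≈[mod] v²≈mv n) ⟩
    v * (m ^ n * v)     ≈⟨ ≈⇒≈[mod] (x∙yz≈y∙xz v (m ^ n) v) ⟩
    m ^ n * (v * v)     ≈⟨ ≈[mod]-*-congˡ (m ^ n) v²≈mv ⟩
    m ^ n * (m * v)     ≈⟨ ≈⇒≈[mod] (x∙yz≈y∙xz (m ^ n) m v) ⟩
    m * (m ^ n * v)     ≈⟨ ≈⇒≈[mod] (*-assoc m (m ^ n) v) ⟨
    m ^ suc n * v       ∎
    where open SetoidReasoning (≈[mod]-setoid e)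

  -- Multiplied by v, the left side becomes a multiple of v v′ ≡ 0 and the right side
  -- b v^(l+2) ≡ b m^(l+1) v.
  powerRelation⇒≈0[mod] : ∀ {e v v′ m} a b l → v * v′ ≈ 0# [mod e ] → v * v ≈ m * v [mod e ] →
                          a * v′ ^ suc l ≈ b * v ^ suc l → b * m ^ suc l * v ≈ 0# [mod e ]
  powerRelation⇒≈0[mod] {e} {v} {v′} {m} a b l vv′≈0 v²≈mv av′≈bv = begin
    b * m ^ suc l * v          ≈⟨ ≈⇒≈[mod] (*-assoc b (m ^ suc l) v) ⟩
    b * (m ^ suc l * v)        ≈⟨ ≈[mod]-*-congˡ b (^suc≈[mod] v²≈mv (suc l)) ⟨
    b * (v * v ^ suc l)        ≈⟨ ≈⇒≈[mod] (x∙yz≈y∙xz b v (v ^ suc l)) ⟩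
    v * (b * v ^ suc l)        ≈⟨ ≈⇒≈[mod] (*-congˡ av′≈bv) ⟨
    v * (a * (v′ * v′ ^ l))    ≈⟨ ≈⇒≈[mod] (*-congˡ (x∙yz≈y∙xz a v′ (v′ ^ l))) ⟩
    v * (v′ * (a * v′ ^ l))    ≈⟨ ≈⇒≈[mod] (*-assoc v v′ (a * v′ ^ l)) ⟨
    v * v′ * (a * v′ ^ l)      ≈⟨ ≈[mod]-*-congʳ (a * v′ ^ l) vv′≈0 ⟩
    0# * (a * v′ ^ l)          ≈⟨ ≈⇒≈[mod] (zeroˡ (a * v′ ^ l)) ⟩
    0#                         ∎
    where open SetoidReasoning (≈[mod]-setoid e)

⊕-comm : ∀ x y → x ⊕ y ≡ y ⊕ x
⊕-comm (q5 a b) (q5 c d) = cong₂ q5 (ℚP.+-comm a c) (ℚP.+-comm b d)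

⊗-comm : ∀ x y → x ⊗ y ≡ y ⊗ x
⊗-comm (q5 a b) (q5 c d) = cong₂ q5
  (solve 5 (λ a b c d r → a :* c :+ r :* (b :* d) := c :* a :+ r :* (d :* b)) refl a b c d five)
  (solve 4 (λ a b c d → a :* d :+ b :* c := c :* b :+ d :* a) refl a b c d)
  where open ℚS

⊗-assoc : ∀ x y z → (x ⊗ y) ⊗ z ≡ x ⊗ (y ⊗ z)
⊗-assoc (q5 a b) (q5 c d) (q5 e f) = cong₂ q5
  (solve 7 (λ a b c d e f r → (a :* c :+ r :* (b :* d)) :* e :+ r :* ((a :* d :+ b :* c) :* f)
                           := a :* (c :* e :+ r :* (d :* f)) :+ r :* (b :* (c :* f :+ d :* e)))
         refl a b c d e f five)
  (solve 7 (λ a b c d e f r → (a :* c :+ r :* (b :* d)) :* f :+ (a :* d :+ b :* c) :* e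
                           := a :* (c :* f :+ d :* e) :+ b :* (c :* e :+ r :* (d :* f)))
         refl a b c d e f five)
  where open ℚS

⊗-identityˡ : ∀ x → 1q ⊗ x ≡ x
⊗-identityˡ (q5 a b) = cong₂ q5
  (solve 3 (λ a b r → con 1ℚ :* a :+ r :* (con 0ℚ :* b) := a) refl a b five)
  (solve 2 (λ a b → con 1ℚ :* b :+ con 0ℚ :* a := b) refl a b)
  where open ℚS

⊗-identityʳ : ∀ x → x ⊗ 1q ≡ x
⊗-identityʳ x = trans (⊗-comm x 1q) (⊗-identityˡ x)

⊗-distribʳ : ∀ x y z → (y ⊕ z) ⊗ x ≡ y ⊗ x ⊕ z ⊗ x
⊗-distribʳ (q5 a b) (q5 c d) (q5 e f) = cong₂ q5
  (solve 7 (λ a b c d e f r → (c :+ e) :* a :+ r :* ((d :+ f) :* b)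
                           := (c :* a :+ r :* (d :* b)) :+ (e :* a :+ r :* (f :* b)))
         refl a b c d e f five)
  (solve 6 (λ a b c d e f → (c :+ e) :* b :+ (d :+ f) :* a := (c :* b :+ d :* a) :+ (e :* b :+ f :* a))
         refl a b c d e f)
  where open ℚS

⊗-distribˡ : ∀ x y z → x ⊗ (y ⊕ z) ≡ x ⊗ y ⊕ x ⊗ z
⊗-distribˡ x y z = begin
  x ⊗ (y ⊕ z)        ≡⟨ ⊗-comm x (y ⊕ z) ⟩
  (y ⊕ z) ⊗ x        ≡⟨ ⊗-distribʳ x y z ⟩
  y ⊗ x ⊕ z ⊗ x      ≡⟨ cong₂ _⊕_ (⊗-comm y x) (⊗-comm z x) ⟩
  x ⊗ y ⊕ x ⊗ z      ∎
  where open ≡-Reasoning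

⊗-commutativeMonoid : CommutativeMonoid 0ℓ 0ℓ
⊗-commutativeMonoid = record
  { Carrier = Q5 ; _≈_ = _≡_ ; _∙_ = _⊗_ ; ε = 1q
  ; isCommutativeMonoid = record
    { isMonoid = record
      { isSemigroup = record
        { isMagma = record { isEquivalence = isEquivalence ; ∙-cong = cong₂ _⊗_ }
        ; assoc   = ⊗-assoc }
      ; identity = ⊗-identityˡ , ⊗-identityʳ }
    ; comm = ⊗-comm } }

open CommSemigroupProperties (CommutativeMonoid.commutativeSemigroup ⊗-commutativeMonoid)
  using (interchange; x∙yz≈y∙xz)

^ℕ-+ : ∀ x m n → x ^ℕ (m ℕ.+ n) ≡ x ^ℕ m ⊗ x ^ℕ n
^ℕ-+ x zero    n = sym (⊗-identityˡ (x ^ℕ n))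
^ℕ-+ x (suc m) n = trans (cong (x ⊗_) (^ℕ-+ x m n)) (sym (⊗-assoc x (x ^ℕ m) (x ^ℕ n)))

^ℕ-distrib-⊗ : ∀ x y n → (x ⊗ y) ^ℕ n ≡ x ^ℕ n ⊗ y ^ℕ n
^ℕ-distrib-⊗ x y zero    = refl
^ℕ-distrib-⊗ x y (suc n) = trans (cong ((x ⊗ y) ⊗_) (^ℕ-distrib-⊗ x y n)) (interchange x y (x ^ℕ n) (y ^ℕ n))

^ℕ-* : ∀ x m n → (x ^ℕ m) ^ℕ n ≡ x ^ℕ (m ℕ.* n)
^ℕ-* x m zero    = cong (x ^ℕ_) (sym (ℕP.*-zeroʳ m))
^ℕ-* x m (suc n) = begin
  x ^ℕ m ⊗ (x ^ℕ m) ^ℕ n     ≡⟨ cong (x ^ℕ m ⊗_) (^ℕ-* x m n) ⟩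
  x ^ℕ m ⊗ x ^ℕ (m ℕ.* n)    ≡⟨ ^ℕ-+ x m (m ℕ.* n) ⟨
  x ^ℕ (m ℕ.+ m ℕ.* n)       ≡⟨ cong (x ^ℕ_) (ℕP.*-suc m n) ⟨
  x ^ℕ (m ℕ.* suc n)         ∎
  where open ≡-Reasoning

1q^ℕ : ∀ n → 1q ^ℕ n ≡ 1q
1q^ℕ zero    = refl
1q^ℕ (suc n) = trans (⊗-identityˡ (1q ^ℕ n)) (1q^ℕ n)

norm-⊗ : ∀ x y → norm (x ⊗ y) ≡ norm x ℚ.* norm y
norm-⊗ (q5 a b) (q5 c d) =
  solve 5 (λ a b c d r → (a :* c :+ r :* (b :* d)) :* (a :* c :+ r :* (b :* d)) :- r :* ((a :* d :+ b :* c) :* (a :* d :+ b :* c))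
                      := (a :* a :- r :* (b :* b)) :* (c :* c :- r :* (d :* d)))
        refl a b c d five
  where open ℚS

⊗-inverseʳ : ∀ x → ¬ norm x ≡ 0ℚ → x ⊗ inv x ≡ 1q
⊗-inverseʳ (q5 a b) N≢0 with norm (q5 a b) ℚP.≟ 0ℚ
... | yes N≡0 = contradiction N≡0 N≢0
... | no  N≢0 = cong₂ q5 re≡1 im≡0
  where
  open ℚS
  instance _ = ℚ.≢-nonZero N≢0
  r = ℚ.1/ norm (q5 a b)
  re≡1 : a ℚ.* (a ℚ.* r) ℚ.+ five ℚ.* (b ℚ.* ((ℚ.- b) ℚ.* r)) ≡ 1ℚ
  re≡1 = trans (solve 4 (λ a b r f → a :* (a :* r) :+ f :* (b :* ((:- b) :* r)) := (a :* a :- f :* (b :* b)) :* r)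
                      refl a b r five)
               (ℚP.*-inverseʳ (norm (q5 a b)))
  im≡0 : a ℚ.* ((ℚ.- b) ℚ.* r) ℚ.+ b ℚ.* (a ℚ.* r) ≡ 0ℚ
  im≡0 = solve 3 (λ a b r → a :* ((:- b) :* r) :+ b :* (a :* r) := con 0ℚ) refl a b r

⊗≡1q⇒norm≢0 : ∀ x y → x ⊗ y ≡ 1q → ¬ norm x ≡ 0ℚ
⊗≡1q⇒norm≢0 x y xy≡1 norm≡0 = contradiction 0≡1 λ ()
  where
  open ≡-Reasoning
  0≡1 : 0ℚ ≡ 1ℚ
  0≡1 = begin
    0ℚ                     ≡⟨ ℚP.*-zeroˡ (norm y) ⟨
    0ℚ ℚ.* norm y          ≡⟨ cong (ℚ._* norm y) norm≡0 ⟨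
    norm x ℚ.* norm y      ≡⟨ norm-⊗ x y ⟨
    norm (x ⊗ y)           ≡⟨ cong norm xy≡1 ⟩
    1ℚ                     ∎

norm-^ℕ≢0 : ∀ x → ¬ norm x ≡ 0ℚ → ∀ n → ¬ norm (x ^ℕ n) ≡ 0ℚ
norm-^ℕ≢0 x x≢0 n = ⊗≡1q⇒norm≢0 (x ^ℕ n) (inv x ^ℕ n) (begin
  x ^ℕ n ⊗ inv x ^ℕ n     ≡⟨ ^ℕ-distrib-⊗ x (inv x) n ⟨
  (x ⊗ inv x) ^ℕ n        ≡⟨ cong (_^ℕ n) (⊗-inverseʳ x x≢0) ⟩
  1q ^ℕ n                 ≡⟨ 1q^ℕ n ⟩
  1q                      ∎)
  where open ≡-Reasoning

pos neg : ℤ → ℕ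
pos (+ n)    = n
pos -[1+ n ] = 0
neg (+ n)    = 0
neg -[1+ n ] = suc n

^ℤ⊗^ℕneg : ∀ x → ¬ norm x ≡ 0ℚ → ∀ k → x ^ℤ k ⊗ x ^ℕ neg k ≡ x ^ℕ pos k
^ℤ⊗^ℕneg x x≢0 (+ n)    = ⊗-identityʳ (x ^ℕ n)
^ℤ⊗^ℕneg x x≢0 -[1+ n ] =
  trans (⊗-comm (inv (x ^ℕ suc n)) (x ^ℕ suc n)) (⊗-inverseʳ (x ^ℕ suc n) (norm-^ℕ≢0 x x≢0 (suc n)))

^ℤ-relation⇒^ℕ-relation : ∀ x y → ¬ norm x ≡ 0ℚ → ¬ norm y ≡ 0ℚ → ∀ k l → x ^ℤ k ⊗ y ^ℤ l ≡ 1q →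
                          x ^ℕ pos k ⊗ y ^ℕ pos l ≡ x ^ℕ neg k ⊗ y ^ℕ neg l
^ℤ-relation⇒^ℕ-relation x y x≢0 y≢0 k l rel = begin
  x ^ℕ pos k ⊗ y ^ℕ pos l                          ≡⟨ cong₂ _⊗_ (^ℤ⊗^ℕneg x x≢0 k) (^ℤ⊗^ℕneg y y≢0 l) ⟨
  (x ^ℤ k ⊗ x ^ℕ neg k) ⊗ (y ^ℤ l ⊗ y ^ℕ neg l)    ≡⟨ interchange (x ^ℤ k) (x ^ℕ neg k) (y ^ℤ l) (y ^ℕ neg l) ⟩
  (x ^ℤ k ⊗ y ^ℤ l) ⊗ (x ^ℕ neg k ⊗ y ^ℕ neg l)    ≡⟨ cong (_⊗ (x ^ℕ neg k ⊗ y ^ℕ neg l)) rel ⟩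
  1q ⊗ (x ^ℕ neg k ⊗ y ^ℕ neg l)                   ≡⟨ ⊗-identityˡ (x ^ℕ neg k ⊗ y ^ℕ neg l) ⟩
  x ^ℕ neg k ⊗ y ^ℕ neg l                          ∎
  where open ≡-Reasoning

-- The ring ℤ[√5]

record ℤ√5 : Set where
  constructor z5
  field
    re₅ : ℤ
    im₅ : ℤ
open ℤ√5

infixl 6 _+₅_
infixl 7 _*₅_

_+₅_ : ℤ√5 → ℤ√5 → ℤ√5
z5 a b +₅ z5 c d = z5 (a ℤ.+ c) (b ℤ.+ d)

_*₅_ : ℤ√5 → ℤ√5 → ℤ√5
z5 a b *₅ z5 c d = z5 (a ℤ.* c ℤ.+ + 5 ℤ.* (b ℤ.* d)) (a ℤ.* d ℤ.+ b ℤ.* c)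

sc : ℤ → ℤ√5
sc a = z5 a (+ 0)

⌜_⌝ : ℕ → ℤ√5
⌜ n ⌝ = sc (+ n)

0₅ 1₅ two : ℤ√5
0₅  = ⌜ 0 ⌝
1₅  = ⌜ 1 ⌝
two = ⌜ 2 ⌝

+₅-assoc : ∀ x y z → (x +₅ y) +₅ z ≡ x +₅ (y +₅ z)
+₅-assoc (z5 a b) (z5 c d) (z5 e f) = cong₂ z5 (ℤP.+-assoc a c e) (ℤP.+-assoc b d f)

+₅-comm : ∀ x y → x +₅ y ≡ y +₅ x
+₅-comm (z5 a b) (z5 c d) = cong₂ z5 (ℤP.+-comm a c) (ℤP.+-comm b d)

+₅-identityˡ : ∀ x → 0₅ +₅ x ≡ x
+₅-identityˡ (z5 a b) = cong₂ z5 (ℤP.+-identityˡ a) (ℤP.+-identityˡ b)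

+₅-identityʳ : ∀ x → x +₅ 0₅ ≡ x
+₅-identityʳ (z5 a b) = cong₂ z5 (ℤP.+-identityʳ a) (ℤP.+-identityʳ b)

*₅-comm : ∀ x y → x *₅ y ≡ y *₅ x
*₅-comm (z5 a b) (z5 c d) = cong₂ z5
  (solve 4 (λ a b c d → a :* c :+ con (+ 5) :* (b :* d) := c :* a :+ con (+ 5) :* (d :* b)) refl a b c d)
  (solve 4 (λ a b c d → a :* d :+ b :* c := c :* b :+ d :* a) refl a b c d)
  where open ℤS

*₅-assoc : ∀ x y z → (x *₅ y) *₅ z ≡ x *₅ (y *₅ z)
*₅-assoc (z5 a b) (z5 c d) (z5 e f) = cong₂ z5
  (solve 6 (λ a b c d e f → (a :* c :+ con (+ 5) :* (b :* d)) :* e :+ con (+ 5) :* ((a :* d :+ b :* c) :* f)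
                         := a :* (c :* e :+ con (+ 5) :* (d :* f)) :+ con (+ 5) :* (b :* (c :* f :+ d :* e)))
         refl a b c d e f)
  (solve 6 (λ a b c d e f → (a :* c :+ con (+ 5) :* (b :* d)) :* f :+ (a :* d :+ b :* c) :* e
                         := a :* (c :* f :+ d :* e) :+ b :* (c :* e :+ con (+ 5) :* (d :* f)))
         refl a b c d e f)
  where open ℤS

*₅-identityˡ : ∀ x → 1₅ *₅ x ≡ x
*₅-identityˡ (z5 a b) = cong₂ z5
  (solve 2 (λ a b → con (+ 1) :* a :+ con (+ 5) :* (con (+ 0) :* b) := a) refl a b)
  (solve 2 (λ a b → con (+ 1) :* b :+ con (+ 0) :* a := b) refl a b)
  where open ℤS

*₅-identityʳ : ∀ x → x *₅ 1₅ ≡ x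
*₅-identityʳ x = trans (*₅-comm x 1₅) (*₅-identityˡ x)

*₅-zeroˡ : ∀ x → 0₅ *₅ x ≡ 0₅
*₅-zeroˡ (z5 a b) = cong₂ z5
  (solve 2 (λ a b → con (+ 0) :* a :+ con (+ 5) :* (con (+ 0) :* b) := con (+ 0)) refl a b)
  (solve 2 (λ a b → con (+ 0) :* b :+ con (+ 0) :* a := con (+ 0)) refl a b)
  where open ℤS

*₅-zeroʳ : ∀ x → x *₅ 0₅ ≡ 0₅
*₅-zeroʳ x = trans (*₅-comm x 0₅) (*₅-zeroˡ x)

*₅-distribʳ : ∀ x y z → (y +₅ z) *₅ x ≡ y *₅ x +₅ z *₅ x
*₅-distribʳ (z5 a b) (z5 c d) (z5 e f) = cong₂ z5
  (solve 6 (λ a b c d e f → (c :+ e) :* a :+ con (+ 5) :* ((d :+ f) :* b)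
                         := (c :* a :+ con (+ 5) :* (d :* b)) :+ (e :* a :+ con (+ 5) :* (f :* b)))
         refl a b c d e f)
  (solve 6 (λ a b c d e f → (c :+ e) :* b :+ (d :+ f) :* a := (c :* b :+ d :* a) :+ (e :* b :+ f :* a))
         refl a b c d e f)
  where open ℤS

*₅-distribˡ : ∀ x y z → x *₅ (y +₅ z) ≡ x *₅ y +₅ x *₅ z
*₅-distribˡ x y z = begin
  x *₅ (y +₅ z)        ≡⟨ *₅-comm x (y +₅ z) ⟩
  (y +₅ z) *₅ x        ≡⟨ *₅-distribʳ x y z ⟩
  y *₅ x +₅ z *₅ x     ≡⟨ cong₂ _+₅_ (*₅-comm y x) (*₅-comm z x) ⟩
  x *₅ y +₅ x *₅ z     ∎
  where open ≡-Reasoning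

ℤ√5-commutativeSemiring : CommutativeSemiring 0ℓ 0ℓ
ℤ√5-commutativeSemiring = record
  { Carrier = ℤ√5 ; _≈_ = _≡_ ; _+_ = _+₅_ ; _*_ = _*₅_ ; 0# = 0₅ ; 1# = 1₅
  ; isCommutativeSemiring = record
    { isSemiring = record
      { isSemiringWithoutAnnihilatingZero = record
        { +-isCommutativeMonoid = record
          { isMonoid = record
            { isSemigroup = record
              { isMagma = record { isEquivalence = isEquivalence ; ∙-cong = cong₂ _+₅_ }
              ; assoc   = +₅-assoc }
            ; identity = +₅-identityˡ , +₅-identityʳ }
          ; comm = +₅-comm }
        ; *-cong     = cong₂ _*₅_
        ; *-assoc    = *₅-assoc
        ; *-identity = *₅-identityˡ , *₅-identityʳ
        ; distrib    = *₅-distribˡ , *₅-distribʳ }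
      ; zero = *₅-zeroˡ , *₅-zeroʳ }
    ; *-comm = *₅-comm } }

open CommSemiringExp ℤ√5-commutativeSemiring
  using () renaming (_^_ to _^₅_; ^-assocʳ to ^₅-*; ^-distrib-* to ^₅-distrib-*₅)
open CommSemigroupProperties (CommutativeSemiring.*-commutativeSemigroup ℤ√5-commutativeSemiring)
  using () renaming (xy∙z≈xz∙y to *₅-xy∙z≈xz∙y)
open Congruence ℤ√5-commutativeSemiring

pos-^ : ∀ m n → (+ m) ℤ.^ n ≡ + (m ℕ.^ n)
pos-^ m zero    = refl
pos-^ m (suc n) = trans (cong (+ m ℤ.*_) (pos-^ m n)) (sym (ℤP.pos-* m (m ℕ.^ n)))

sc-*₅ : ∀ a b → sc a *₅ sc b ≡ sc (a ℤ.* b)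
sc-*₅ a b = cong₂ z5
  (solve 2 (λ a b → a :* b :+ con (+ 5) :* (con (+ 0) :* con (+ 0)) := a :* b) refl a b)
  (solve 2 (λ a b → a :* con (+ 0) :+ con (+ 0) :* b := con (+ 0)) refl a b)
  where open ℤS

sc-^₅ : ∀ a n → sc a ^₅ n ≡ sc (a ℤ.^ n)
sc-^₅ a zero    = refl
sc-^₅ a (suc n) = trans (cong (sc a *₅_) (sc-^₅ a n)) (sc-*₅ a (a ℤ.^ n))

⌜⌝-*₅ : ∀ m n → ⌜ m ⌝ *₅ ⌜ n ⌝ ≡ ⌜ m ℕ.* n ⌝
⌜⌝-*₅ m n = trans (sc-*₅ (+ m) (+ n)) (cong sc (sym (ℤP.pos-* m n)))

⌜⌝-^₅ : ∀ m n → ⌜ m ⌝ ^₅ n ≡ ⌜ m ℕ.^ n ⌝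
⌜⌝-^₅ m n = trans (sc-^₅ (+ m) n) (cong sc (pos-^ m n))

re₅-sc-*₅ : ∀ c z → re₅ (sc c *₅ z) ≡ c ℤ.* re₅ z
re₅-sc-*₅ c (z5 a b) = solve 3 (λ c a b → c :* a :+ con (+ 5) :* (con (+ 0) :* b) := c :* a) refl c a b
  where open ℤS

im₅-sc-*₅ : ∀ c z → im₅ (sc c *₅ z) ≡ c ℤ.* im₅ z
im₅-sc-*₅ c (z5 a b) = solve 3 (λ c a b → c :* b :+ con (+ 0) :* a := c :* b) refl c a b
  where open ℤS

cj : ℤ√5 → ℤ√5
cj (z5 a b) = z5 a (ℤ.- b)

cj-+₅ : ∀ x y → cj (x +₅ y) ≡ cj x +₅ cj y
cj-+₅ (z5 a b) (z5 c d) = cong (z5 (a ℤ.+ c)) (ℤP.neg-distrib-+ b d)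

cj-*₅ : ∀ x y → cj (x *₅ y) ≡ cj x *₅ cj y
cj-*₅ (z5 a b) (z5 c d) = cong₂ z5
  (solve 4 (λ a b c d → a :* c :+ con (+ 5) :* (b :* d) := a :* c :+ con (+ 5) :* ((:- b) :* (:- d))) refl a b c d)
  (solve 4 (λ a b c d → :- (a :* d :+ b :* c) := a :* (:- d) :+ (:- b) :* c) refl a b c d)
  where open ℤS

cj-^₅ : ∀ x n → cj (x ^₅ n) ≡ cj x ^₅ n
cj-^₅ x zero    = refl
cj-^₅ x (suc n) = trans (cj-*₅ x (x ^₅ n)) (cong (cj x *₅_) (cj-^₅ x n))

N : ℤ√5 → ℤ
N (z5 a b) = a ℤ.* a ℤ.- + 5 ℤ.* (b ℤ.* b)

N-*₅ : ∀ x y → N (x *₅ y) ≡ N x ℤ.* N y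
N-*₅ (z5 a b) (z5 c d) = solve 4 (λ a b c d →
    (a :* c :+ con (+ 5) :* (b :* d)) :* (a :* c :+ con (+ 5) :* (b :* d)) :- con (+ 5) :* ((a :* d :+ b :* c) :* (a :* d :+ b :* c))
    := (a :* a :- con (+ 5) :* (b :* b)) :* (c :* c :- con (+ 5) :* (d :* d))) refl a b c d
  where open ℤS

N-^₅ : ∀ x n → N (x ^₅ n) ≡ N x ℤ.^ n
N-^₅ x zero    = refl
N-^₅ x (suc n) = trans (N-*₅ x (x ^₅ n)) (cong (N x ℤ.*_) (N-^₅ x n))

N-cj : ∀ x → N (cj x) ≡ N x
N-cj (z5 a b) = solve 2 (λ a b → a :* a :- con (+ 5) :* ((:- b) :* (:- b)) := a :* a :- con (+ 5) :* (b :* b)) refl a b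
  where open ℤS

N-+₅sc : ∀ x t → N (x +₅ sc t) ≡ N x ℤ.+ t ℤ.* (t ℤ.+ + 2 ℤ.* re₅ x)
N-+₅sc (z5 a b) t = solve 3 (λ a b t →
    (a :+ t) :* (a :+ t) :- con (+ 5) :* ((b :+ con (+ 0)) :* (b :+ con (+ 0)))
    := (a :* a :- con (+ 5) :* (b :* b)) :+ t :* (t :+ con (+ 2) :* a)) refl a b t
  where open ℤS

*₅-cj : ∀ x → x *₅ cj x ≡ sc (N x)
*₅-cj (z5 a b) = cong₂ z5
  (solve 2 (λ a b → a :* a :+ con (+ 5) :* (b :* (:- b)) := a :* a :- con (+ 5) :* (b :* b)) refl a b)
  (solve 2 (λ a b → a :* (:- b) :+ b :* a := con (+ 0)) refl a b)
  where open ℤS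

cayley-hamilton : ∀ x → x *₅ x +₅ sc (N x) ≡ sc (+ 2 ℤ.* re₅ x) *₅ x
cayley-hamilton (z5 a b) = cong₂ z5
  (solve 2 (λ a b → (a :* a :+ con (+ 5) :* (b :* b)) :+ (a :* a :- con (+ 5) :* (b :* b))
                 := con (+ 2) :* a :* a :+ con (+ 5) :* (con (+ 0) :* b)) refl a b)
  (solve 2 (λ a b → (a :* b :+ b :* a) :+ con (+ 0) := con (+ 2) :* a :* b :+ con (+ 0) :* a) refl a b)
  where open ℤS

⌜⌝*≈0[mod]⇒∣ : ∀ c E z → ⌜ c ⌝ *₅ z ≈ 0₅ [mod ⌜ E ⌝ ] → E ∣ c ℕ.* ℤ.∣ re₅ z ∣
⌜⌝*≈0[mod]⇒∣ c E z (r , s , eq) = divides ℤ.∣ re₅ s ℤ.- re₅ r ∣ (begin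
  c ℕ.* ℤ.∣ re₅ z ∣                   ≡⟨ ℤP.abs-* (+ c) (re₅ z) ⟨
  ℤ.∣ + c ℤ.* re₅ z ∣                 ≡⟨ cong ℤ.∣_∣ re-eq ⟩
  ℤ.∣ + E ℤ.* (re₅ s ℤ.- re₅ r) ∣     ≡⟨ ℤP.abs-* (+ E) (re₅ s ℤ.- re₅ r) ⟩
  E ℕ.* ℤ.∣ re₅ s ℤ.- re₅ r ∣         ≡⟨ ℕP.*-comm E ℤ.∣ re₅ s ℤ.- re₅ r ∣ ⟩
  ℤ.∣ re₅ s ℤ.- re₅ r ∣ ℕ.* E         ∎)
  where
  open ≡-Reasoning
  add-sub : ∀ a b → a ≡ (a ℤ.+ b) ℤ.- b
  add-sub = ℤ-Tactic.solve-∀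
  factor : ∀ e s r → (+ 0 ℤ.+ e ℤ.* s) ℤ.- e ℤ.* r ≡ e ℤ.* (s ℤ.- r)
  factor = ℤ-Tactic.solve-∀
  re-eq : + c ℤ.* re₅ z ≡ + E ℤ.* (re₅ s ℤ.- re₅ r)
  re-eq = begin
    + c ℤ.* re₅ z                                              ≡⟨ add-sub (+ c ℤ.* re₅ z) (+ E ℤ.* re₅ r) ⟩
    (+ c ℤ.* re₅ z ℤ.+ + E ℤ.* re₅ r) ℤ.- + E ℤ.* re₅ r         ≡⟨ cong₂ (λ u v → (u ℤ.+ v) ℤ.- + E ℤ.* re₅ r)
                                                                        (re₅-sc-*₅ (+ c) z) (re₅-sc-*₅ (+ E) r) ⟨
    (re₅ (⌜ c ⌝ *₅ z) ℤ.+ re₅ (⌜ E ⌝ *₅ r)) ℤ.- + E ℤ.* re₅ r   ≡⟨ cong (λ u → re₅ u ℤ.- + E ℤ.* re₅ r) eq ⟩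
    (+ 0 ℤ.+ re₅ (⌜ E ⌝ *₅ s)) ℤ.- + E ℤ.* re₅ r               ≡⟨ cong (λ u → (+ 0 ℤ.+ u) ℤ.- + E ℤ.* re₅ r)
                                                                        (re₅-sc-*₅ (+ E) s) ⟩
    (+ 0 ℤ.+ + E ℤ.* re₅ s) ℤ.- + E ℤ.* re₅ r                  ≡⟨ factor (+ E) (re₅ s) (re₅ r) ⟩
    + E ℤ.* (re₅ s ℤ.- re₅ r)                                  ∎

-- ℤ[√5][½] inside ℚ(√5)

fromℤ-+ : ∀ a b → fromℤ (a ℤ.+ b) ≡ fromℤ a ℚ.+ fromℤ b
fromℤ-+ a b = ℚP.toℚᵘ-injective (ℚᵘP.≃-trans (ℚᵘ.*≡* eq) (ℚᵘP.≃-sym (ℚP.toℚᵘ-homo-+ (fromℤ a) (fromℤ b))))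
  where
  open ℤS
  eq = solve 2 (λ a b → (a :+ b) :* (con (+ 1) :* con (+ 1)) := (a :* con (+ 1) :+ b :* con (+ 1)) :* con (+ 1)) refl a b

fromℤ-* : ∀ a b → fromℤ (a ℤ.* b) ≡ fromℤ a ℚ.* fromℤ b
fromℤ-* a b = ℚP.toℚᵘ-injective (ℚᵘP.≃-trans (ℚᵘ.*≡* eq) (ℚᵘP.≃-sym (ℚP.toℚᵘ-homo-* (fromℤ a) (fromℤ b))))
  where
  open ℤS
  eq = solve 2 (λ a b → (a :* b) :* (con (+ 1) :* con (+ 1)) := (a :* b) :* con (+ 1)) refl a b

fromℤ-neg : ∀ a → fromℤ (ℤ.- a) ≡ ℚ.- fromℤ a
fromℤ-neg (+ zero)  = refl
fromℤ-neg (+ suc n) = refl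
fromℤ-neg -[1+ n ]  = refl

ι : ℤ√5 → Q5
ι (z5 a b) = q5 (fromℤ a) (fromℤ b)

ι-+ : ∀ x y → ι (x +₅ y) ≡ ι x ⊕ ι y
ι-+ (z5 a b) (z5 c d) = cong₂ q5 (fromℤ-+ a c) (fromℤ-+ b d)

ι-* : ∀ x y → ι (x *₅ y) ≡ ι x ⊗ ι y
ι-* (z5 a b) (z5 c d) = cong₂ q5
  (trans (fromℤ-+ (a ℤ.* c) (+ 5 ℤ.* (b ℤ.* d)))
    (cong₂ ℚ._+_ (fromℤ-* a c) (trans (fromℤ-* (+ 5) (b ℤ.* d)) (cong (five ℚ.*_) (fromℤ-* b d)))))
  (trans (fromℤ-+ (a ℤ.* d) (b ℤ.* c)) (cong₂ ℚ._+_ (fromℤ-* a d) (fromℤ-* b c)))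

ι-^ : ∀ x n → ι (x ^₅ n) ≡ ι x ^ℕ n
ι-^ x zero    = refl
ι-^ x (suc n) = trans (ι-* x (x ^₅ n)) (cong (ι x ⊗_) (ι-^ x n))

ι-injective : ∀ {x y} → ι x ≡ ι y → x ≡ y
ι-injective {z5 a b} {z5 c d} eq = cong₂ z5 (cong (ℚ.numerator ∘ re) eq) (cong (ℚ.numerator ∘ im) eq)

norm-ι : ∀ x → norm (ι x) ≡ fromℤ (N x)
norm-ι (z5 a b) = sym (begin
  fromℤ (a ℤ.* a ℤ.- + 5 ℤ.* (b ℤ.* b))                  ≡⟨ fromℤ-+ (a ℤ.* a) (ℤ.- (+ 5 ℤ.* (b ℤ.* b))) ⟩
  fromℤ (a ℤ.* a) ℚ.+ fromℤ (ℤ.- (+ 5 ℤ.* (b ℤ.* b)))    ≡⟨ cong₂ ℚ._+_ (fromℤ-* a a) (fromℤ-neg (+ 5 ℤ.* (b ℤ.* b))) ⟩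
  fromℤ a ℚ.* fromℤ a ℚ.- fromℤ (+ 5 ℤ.* (b ℤ.* b))      ≡⟨ cong (λ u → fromℤ a ℚ.* fromℤ a ℚ.- u)
                                                              (trans (fromℤ-* (+ 5) (b ℤ.* b)) (cong (five ℚ.*_) (fromℤ-* b b))) ⟩
  fromℤ a ℚ.* fromℤ a ℚ.- five ℚ.* (fromℤ b ℚ.* fromℤ b) ∎)
  where open ≡-Reasoning

half : Q5
half = q5 ½ 0ℚ

dyadic : ℕ → ℤ√5 → Q5
dyadic n z = half ^ℕ n ⊗ ι z

dyadic-⊗ : ∀ m n z y → dyadic m z ⊗ dyadic n y ≡ dyadic (m ℕ.+ n) (z *₅ y)
dyadic-⊗ m n z y = trans (interchange (half ^ℕ m) (ι z) (half ^ℕ n) (ι y)) (sym (cong₂ _⊗_ (^ℕ-+ half m n) (ι-* z y)))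

dyadic-^ : ∀ m z n → dyadic m z ^ℕ n ≡ dyadic (m ℕ.* n) (z ^₅ n)
dyadic-^ m z n = trans (^ℕ-distrib-⊗ (half ^ℕ m) (ι z) n) (cong₂ _⊗_ (^ℕ-* half m n) (sym (ι-^ z n)))

dyadic-⊕ : ∀ n z y → dyadic n z ⊕ dyadic n y ≡ dyadic n (z +₅ y)
dyadic-⊕ n z y = trans (sym (⊗-distribˡ (half ^ℕ n) (ι z) (ι y))) (cong (half ^ℕ n ⊗_) (sym (ι-+ z y)))

dyadic-2^ : ∀ n → dyadic n (two ^₅ n) ≡ 1q
dyadic-2^ n = begin
  half ^ℕ n ⊗ ι (two ^₅ n)     ≡⟨ cong (half ^ℕ n ⊗_) (ι-^ two n) ⟩
  half ^ℕ n ⊗ ι two ^ℕ n       ≡⟨ ^ℕ-distrib-⊗ half (ι two) n ⟨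
  (half ⊗ ι two) ^ℕ n          ≡⟨ 1q^ℕ n ⟩
  1q                        ∎
  where open ≡-Reasoning

dyadic-clear : ∀ n z y → dyadic n z ⊗ ι (two ^₅ n *₅ y) ≡ ι (z *₅ y)
dyadic-clear n z y = begin
  (half ^ℕ n ⊗ ι z) ⊗ ι (two ^₅ n *₅ y)        ≡⟨ cong (dyadic n z ⊗_) (ι-* (two ^₅ n) y) ⟩
  (half ^ℕ n ⊗ ι z) ⊗ (ι (two ^₅ n) ⊗ ι y)     ≡⟨ interchange (half ^ℕ n) (ι z) (ι (two ^₅ n)) (ι y) ⟩
  dyadic n (two ^₅ n) ⊗ (ι z ⊗ ι y)         ≡⟨ cong₂ _⊗_ (dyadic-2^ n) (sym (ι-* z y)) ⟩
  1q ⊗ ι (z *₅ y)                           ≡⟨ ⊗-identityˡ (ι (z *₅ y)) ⟩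
  ι (z *₅ y)                                ∎
  where open ≡-Reasoning

dyadic-injective : ∀ m n z y → dyadic m z ≡ dyadic n y → z *₅ two ^₅ n ≡ y *₅ two ^₅ m
dyadic-injective m n z y eq = ι-injective (begin
  ι (z *₅ two ^₅ n)                     ≡⟨ dyadic-clear m z (two ^₅ n) ⟨
  dyadic m z ⊗ ι (two ^₅ m *₅ two ^₅ n) ≡⟨ cong₂ _⊗_ eq (cong ι (*₅-comm (two ^₅ m) (two ^₅ n))) ⟩
  dyadic n y ⊗ ι (two ^₅ n *₅ two ^₅ m) ≡⟨ dyadic-clear n y (two ^₅ m) ⟩
  ι (y *₅ two ^₅ m)                     ∎)
  where open ≡-Reasoning

norm-dyadic≢0 : ∀ n z → ¬ N z ≡ + 0 → ¬ norm (dyadic n z) ≡ 0ℚ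
norm-dyadic≢0 n z Nz≢0 norm≡0 = Nz≢0 (cong ℚ.numerator (begin
  fromℤ (N z)                                  ≡⟨ norm-ι z ⟨
  norm (ι z)                                   ≡⟨ cong norm ι≡dyadic⊗2^ ⟩
  norm (dyadic n z ⊗ ι (two ^₅ n))             ≡⟨ norm-⊗ (dyadic n z) (ι (two ^₅ n)) ⟩
  norm (dyadic n z) ℚ.* norm (ι (two ^₅ n))    ≡⟨ cong (ℚ._* norm (ι (two ^₅ n))) norm≡0 ⟩
  0ℚ ℚ.* norm (ι (two ^₅ n))                   ≡⟨ ℚP.*-zeroˡ (norm (ι (two ^₅ n))) ⟩
  0ℚ                                           ∎))
  where
  open ≡-Reasoning
  ι≡dyadic⊗2^ : ι z ≡ dyadic n z ⊗ ι (two ^₅ n)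
  ι≡dyadic⊗2^ = begin
    ι z                                 ≡⟨ cong ι (*₅-identityʳ z) ⟨
    ι (z *₅ 1₅)                         ≡⟨ dyadic-clear n z 1₅ ⟨
    dyadic n z ⊗ ι (two ^₅ n *₅ 1₅)     ≡⟨ cong (λ w → dyadic n z ⊗ ι w) (*₅-identityʳ (two ^₅ n)) ⟩
    dyadic n z ⊗ ι (two ^₅ n)           ∎

U W : ℤ√5
U = z5 (+ 1) (+ 1)
W = z5 -[1+ 5 ] -[1+ 1 ]

α≡dyadic : α ≡ dyadic 1 U
α≡dyadic = refl

β≡dyadic : β ≡ dyadic 1 (cj U)
β≡dyadic = refl

α⊘β≡dyadic : α ⊘ β ≡ dyadic 2 W
α⊘β≡dyadic = refl

α⊘β≡αβ⊗α² : α ⊘ β ≡ (β ⊗ α) ⊗ (α ⊗ α)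
α⊘β≡αβ⊗α² = refl

[βα]²≡1 : (β ⊗ α) ^ℕ 2 ≡ 1q
[βα]²≡1 = refl

W≡-U² : W ≡ sc -[1+ 0 ] *₅ U ^₅ 2
W≡-U² = refl

cjW*W≡16 : cj W *₅ W ≡ ⌜ 16 ⌝
cjW*W≡16 = refl

α⊘β^≡dyadic : ∀ n → (α ⊘ β) ^ℕ n ≡ dyadic (2 ℕ.* n) (W ^₅ n)
α⊘β^≡dyadic n = trans (cong (_^ℕ n) α⊘β≡dyadic) (dyadic-^ 2 W n)

norm-α⊘β≢0 : ¬ norm (α ⊘ β) ≡ 0ℚ
norm-α⊘β≢0 ()

U^≡ : ∀ n → U ^₅ n ≡ z5 (+ uRe n) (+ uIm n)
U^≡ zero    = refl
U^≡ (suc n) = trans (cong (U *₅_) (U^≡ n)) (cong₂ z5 (re-step (uRe n) (uIm n)) (im-step (uRe n) (uIm n)))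
  where
  re-step : ∀ a b → + 1 ℤ.* + a ℤ.+ + 5 ℤ.* (+ 1 ℤ.* + b) ≡ + (a ℕ.+ 5 ℕ.* b)
  re-step a b = trans (unit (+ a) (+ b)) (sym (trans (ℤP.pos-+ a (5 ℕ.* b)) (cong (ℤ._+_ (+ a)) (ℤP.pos-* 5 b))))
    where
    unit : ∀ a b → + 1 ℤ.* a ℤ.+ + 5 ℤ.* (+ 1 ℤ.* b) ≡ a ℤ.+ + 5 ℤ.* b
    unit = ℤ-Tactic.solve-∀
  im-step : ∀ a b → + 1 ℤ.* + b ℤ.+ + 1 ℤ.* + a ≡ + (a ℕ.+ b)
  im-step a b = trans (unit (+ a) (+ b)) (sym (ℤP.pos-+ a b))
    where
    unit : ∀ a b → + 1 ℤ.* b ℤ.+ + 1 ℤ.* a ≡ a ℤ.+ b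
    unit = ℤ-Tactic.solve-∀

V : ℕ → ℤ√5
V x = U ^₅ x +₅ two ^₅ x

P Q G : ℕ → Q5
P x = α ^ℕ x ⊕ 1q
Q x = β ^ℕ x ⊕ 1q
G x = Q x ⊘ P x

P≡dyadic : ∀ x → P x ≡ dyadic x (V x)
P≡dyadic x = begin
  α ^ℕ x ⊕ 1q                                 ≡⟨ cong₂ _⊕_ (cong (_^ℕ x) α≡dyadic) (sym (dyadic-2^ x)) ⟩
  dyadic 1 U ^ℕ x ⊕ dyadic x (two ^₅ x)       ≡⟨ cong (_⊕ dyadic x (two ^₅ x)) (trans (dyadic-^ 1 U x)
                                                   (cong (λ k → dyadic k (U ^₅ x)) (ℕP.*-identityˡ x))) ⟩
  dyadic x (U ^₅ x) ⊕ dyadic x (two ^₅ x)     ≡⟨ dyadic-⊕ x (U ^₅ x) (two ^₅ x) ⟩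
  dyadic x (V x)                              ∎
  where open ≡-Reasoning

Q≡dyadic : ∀ x → Q x ≡ dyadic x (cj (V x))
Q≡dyadic x = begin
  β ^ℕ x ⊕ 1q                                 ≡⟨ cong₂ _⊕_ (cong (_^ℕ x) β≡dyadic) (sym (dyadic-2^ x)) ⟩
  dyadic 1 (cj U) ^ℕ x ⊕ dyadic x (two ^₅ x)  ≡⟨ cong (_⊕ dyadic x (two ^₅ x)) (trans (dyadic-^ 1 (cj U) x)
                                                   (cong (λ k → dyadic k (cj U ^₅ x)) (ℕP.*-identityˡ x))) ⟩
  dyadic x (cj U ^₅ x) ⊕ dyadic x (two ^₅ x)  ≡⟨ dyadic-⊕ x (cj U ^₅ x) (two ^₅ x) ⟩
  dyadic x (cj U ^₅ x +₅ two ^₅ x)            ≡⟨ cong (dyadic x) (cong₂ _+₅_ (sym (cj-^₅ U x)) (sym (cj-^₅ two x))) ⟩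
  dyadic x (cj (U ^₅ x) +₅ cj (two ^₅ x))     ≡⟨ cong (dyadic x) (sym (cj-+₅ (U ^₅ x) (two ^₅ x))) ⟩
  dyadic x (cj (V x))                         ∎
  where open ≡-Reasoning

4^≡2^*2^ : ∀ n → (+ 4) ℤ.^ n ≡ + (2 ℕ.^ n) ℤ.* + (2 ℕ.^ n)
4^≡2^*2^ n = begin
  (+ 4) ℤ.^ n                     ≡⟨ pos-^ 4 n ⟩
  + ((2 ℕ.^ 2) ℕ.^ n)             ≡⟨ cong +_ (ℕP.^-*-assoc 2 2 n) ⟩
  + (2 ℕ.^ (n ℕ.+ (n ℕ.+ 0)))     ≡⟨ cong (λ k → + (2 ℕ.^ (n ℕ.+ k))) (ℕP.+-identityʳ n) ⟩
  + (2 ℕ.^ (n ℕ.+ n))             ≡⟨ cong +_ (ℕP.^-distribˡ-+-* 2 n n) ⟩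
  + (2 ℕ.^ n ℕ.* 2 ℕ.^ n)         ≡⟨ ℤP.pos-* (2 ℕ.^ n) (2 ℕ.^ n) ⟩
  + (2 ℕ.^ n) ℤ.* + (2 ℕ.^ n)     ∎
  where open ≡-Reasoning

-4^even : ∀ m → -[1+ 3 ] ℤ.^ (2 ℕ.* m) ≡ (+ 4) ℤ.^ (2 ℕ.* m)
-4^even m = trans (sym (ℤP.^-*-assoc -[1+ 3 ] 2 m)) (ℤP.^-*-assoc (+ 4) 2 m)

-4^odd : ∀ m → -[1+ 3 ] ℤ.^ (1 ℕ.+ 2 ℕ.* m) ≡ ℤ.- ((+ 4) ℤ.^ (1 ℕ.+ 2 ℕ.* m))
-4^odd m = trans (cong (-[1+ 3 ] ℤ.*_) (-4^even m)) (sym (ℤP.neg-distribˡ-* (+ 4) ((+ 4) ℤ.^ (2 ℕ.* m))))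

N-V : ∀ x → N (V x) ≡ -[1+ 3 ] ℤ.^ x ℤ.+ + (2 ℕ.^ x) ℤ.* (+ (2 ℕ.^ x) ℤ.+ + 2 ℤ.* + uRe x)
N-V x = begin
  N (U ^₅ x +₅ two ^₅ x)                              ≡⟨ cong (λ y → N (U ^₅ x +₅ y)) (⌜⌝-^₅ 2 x) ⟩
  N (U ^₅ x +₅ sc t)                                  ≡⟨ N-+₅sc (U ^₅ x) t ⟩
  N (U ^₅ x) ℤ.+ t ℤ.* (t ℤ.+ + 2 ℤ.* re₅ (U ^₅ x))   ≡⟨ cong₂ (λ n e → n ℤ.+ t ℤ.* (t ℤ.+ + 2 ℤ.* e))
                                                               (N-^₅ U x) (cong re₅ (U^≡ x)) ⟩
  -[1+ 3 ] ℤ.^ x ℤ.+ t ℤ.* (t ℤ.+ + 2 ℤ.* + uRe x)    ∎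
  where
  open ≡-Reasoning
  t = + (2 ℕ.^ x)

N-V-odd : ∀ m → let x = 1 ℕ.+ 2 ℕ.* m in N (V x) ≡ + 2 ℤ.* (+ (2 ℕ.^ x) ℤ.* + uRe x)
N-V-odd m = begin
  N (V x)                                       ≡⟨ N-V x ⟩
  -[1+ 3 ] ℤ.^ x ℤ.+ t ℤ.* (t ℤ.+ + 2 ℤ.* e)    ≡⟨ cong (ℤ._+ t ℤ.* (t ℤ.+ + 2 ℤ.* e))
                                                        (trans (-4^odd m) (cong ℤ.-_ (4^≡2^*2^ x))) ⟩
  ℤ.- (t ℤ.* t) ℤ.+ t ℤ.* (t ℤ.+ + 2 ℤ.* e)     ≡⟨ cancel t e ⟩
  + 2 ℤ.* (t ℤ.* e)                             ∎
  where
  open ≡-Reasoning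
  x = 1 ℕ.+ 2 ℕ.* m
  t = + (2 ℕ.^ x)
  e = + uRe x
  cancel : ∀ t e → ℤ.- (t ℤ.* t) ℤ.+ t ℤ.* (t ℤ.+ + 2 ℤ.* e) ≡ + 2 ℤ.* (t ℤ.* e)
  cancel = ℤ-Tactic.solve-∀

N-V-even : ∀ m → let x = 2 ℕ.* m in N (V x) ≡ + 2 ℤ.* (+ (2 ℕ.^ x) ℤ.* (+ (2 ℕ.^ x) ℤ.+ + uRe x))
N-V-even m = begin
  N (V x)                                       ≡⟨ N-V x ⟩
  -[1+ 3 ] ℤ.^ x ℤ.+ t ℤ.* (t ℤ.+ + 2 ℤ.* e)    ≡⟨ cong (ℤ._+ t ℤ.* (t ℤ.+ + 2 ℤ.* e)) (trans (-4^even m) (4^≡2^*2^ x)) ⟩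
  t ℤ.* t ℤ.+ t ℤ.* (t ℤ.+ + 2 ℤ.* e)           ≡⟨ collect t e ⟩
  + 2 ℤ.* (t ℤ.* (t ℤ.+ e))                     ∎
  where
  open ≡-Reasoning
  x = 2 ℕ.* m
  t = + (2 ℕ.^ x)
  e = + uRe x
  collect : ∀ t e → t ℤ.* t ℤ.+ t ℤ.* (t ℤ.+ + 2 ℤ.* e) ≡ + 2 ℤ.* (t ℤ.* (t ℤ.+ e))
  collect = ℤ-Tactic.solve-∀

2*[2^*s]≢0 : ∀ x s → ¬ s ≡ + 0 → ¬ + 2 ℤ.* (+ (2 ℕ.^ x) ℤ.* s) ≡ + 0
2*[2^*s]≢0 x s s≢0 eq with ℤP.i*j≡0⇒i≡0∨j≡0 (+ 2) eq
... | inj₂ ts≡0 with ℤP.i*j≡0⇒i≡0∨j≡0 (+ (2 ℕ.^ x)) ts≡0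
...   | inj₁ t≡0 with ℕP.m^n≡0⇒m≡0 2 x (ℤP.+-injective t≡0)
...     | ()
2*[2^*s]≢0 x s s≢0 eq | inj₂ ts≡0 | inj₂ s≡0 = s≢0 s≡0

N-V≢0 : ∀ x → ¬ N (V x) ≡ + 0
N-V≢0 x with parity x
... | odd m  = 2*[2^*s]≢0 x (+ uRe x) (uRe≢0 x ∘ ℤP.+-injective) ∘ trans (sym (N-V-odd m))
... | even m = 2*[2^*s]≢0 x (+ (2 ℕ.^ x) ℤ.+ + uRe x) t+e≢0 ∘ trans (sym (N-V-even m))
  where
  t+e≢0 : ¬ + (2 ℕ.^ x) ℤ.+ + uRe x ≡ + 0
  t+e≢0 eq = uRe≢0 x (ℕP.m+n≡0⇒n≡0 (2 ℕ.^ x) (ℤP.+-injective (trans (ℤP.pos-+ (2 ℕ.^ x) (uRe x)) eq)))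

norm-P≢0 : ∀ x → ¬ norm (P x) ≡ 0ℚ
norm-P≢0 x = subst (λ y → ¬ norm y ≡ 0ℚ) (sym (P≡dyadic x)) (norm-dyadic≢0 x (V x) (N-V≢0 x))

norm-Q≢0 : ∀ x → ¬ norm (Q x) ≡ 0ℚ
norm-Q≢0 x = subst (λ y → ¬ norm y ≡ 0ℚ) (sym (Q≡dyadic x))
  (norm-dyadic≢0 x (cj (V x)) (N-V≢0 x ∘ trans (sym (N-cj (V x)))))

G⊗P≡Q : ∀ x → G x ⊗ P x ≡ Q x
G⊗P≡Q x = begin
  (Q x ⊗ inv (P x)) ⊗ P x     ≡⟨ ⊗-assoc (Q x) (inv (P x)) (P x) ⟩
  Q x ⊗ (inv (P x) ⊗ P x)     ≡⟨ cong (Q x ⊗_) (trans (⊗-comm (inv (P x)) (P x)) (⊗-inverseʳ (P x) (norm-P≢0 x))) ⟩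
  Q x ⊗ 1q                    ≡⟨ ⊗-identityʳ (Q x) ⟩
  Q x                         ∎
  where open ≡-Reasoning

norm-G≢0 : ∀ x → ¬ norm (G x) ≡ 0ℚ
norm-G≢0 x = ⊗≡1q⇒norm≢0 (G x) (P x ⊗ inv (Q x)) (begin
  G x ⊗ (P x ⊗ inv (Q x))     ≡⟨ ⊗-assoc (G x) (P x) (inv (Q x)) ⟨
  (G x ⊗ P x) ⊗ inv (Q x)     ≡⟨ cong (_⊗ inv (Q x)) (G⊗P≡Q x) ⟩
  Q x ⊗ inv (Q x)             ≡⟨ ⊗-inverseʳ (Q x) (norm-Q≢0 x) ⟩
  1q                          ∎)
  where open ≡-Reasoning

-- αβ = -1 makes G x = α^(-x), and α/β = -α².
even⇒dependent : ∀ m → MultDep (α ⊘ β) (G (2 ℕ.* m))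
even⇒dependent m = + x , + 2 , (λ { (_ , ()) }) , (begin
  (α ⊘ β) ^ℕ x ⊗ G x ^ℕ 2                        ≡⟨ cong (λ y → y ^ℕ x ⊗ G x ^ℕ 2) α⊘β≡αβ⊗α² ⟩
  ((β ⊗ α) ⊗ (α ⊗ α)) ^ℕ x ⊗ G x ^ℕ 2            ≡⟨ cong (_⊗ G x ^ℕ 2) (^ℕ-distrib-⊗ (β ⊗ α) (α ⊗ α) x) ⟩
  ((β ⊗ α) ^ℕ x ⊗ (α ⊗ α) ^ℕ x) ⊗ G x ^ℕ 2       ≡⟨ cong₂ (λ u v → (u ⊗ v) ⊗ G x ^ℕ 2) [βα]^x≡1 (^ℕ-distrib-⊗ α α x) ⟩
  (1q ⊗ (a ⊗ a)) ⊗ (G x ⊗ (G x ⊗ 1q))            ≡⟨ cong₂ _⊗_ (⊗-identityˡ (a ⊗ a)) (cong (G x ⊗_) (⊗-identityʳ (G x))) ⟩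
  (a ⊗ a) ⊗ (G x ⊗ G x)                          ≡⟨ interchange a a (G x) (G x) ⟩
  (a ⊗ G x) ⊗ (a ⊗ G x)                          ≡⟨ cong₂ _⊗_ α^⊗G≡1 α^⊗G≡1 ⟩
  1q ⊗ 1q                                        ≡⟨ ⊗-identityˡ 1q ⟩
  1q                                             ∎)
  where
  open ≡-Reasoning
  x = 2 ℕ.* m
  a = α ^ℕ x
  [βα]^x≡1 : (β ⊗ α) ^ℕ x ≡ 1q
  [βα]^x≡1 = trans (sym (^ℕ-* (β ⊗ α) 2 m)) (trans (cong (_^ℕ m) [βα]²≡1) (1q^ℕ m))
  Q⊗α^≡P : Q x ⊗ a ≡ P x
  Q⊗α^≡P = begin
    (β ^ℕ x ⊕ 1q) ⊗ a         ≡⟨ ⊗-distribʳ a (β ^ℕ x) 1q ⟩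
    β ^ℕ x ⊗ a ⊕ 1q ⊗ a       ≡⟨ cong₂ _⊕_ (trans (sym (^ℕ-distrib-⊗ β α x)) [βα]^x≡1) (⊗-identityˡ a) ⟩
    1q ⊕ a                    ≡⟨ ⊕-comm 1q a ⟩
    a ⊕ 1q                    ∎
  α^⊗G≡1 : a ⊗ G x ≡ 1q
  α^⊗G≡1 = begin
    a ⊗ (Q x ⊗ inv (P x))     ≡⟨ x∙yz≈y∙xz a (Q x) (inv (P x)) ⟩
    Q x ⊗ (a ⊗ inv (P x))     ≡⟨ ⊗-assoc (Q x) a (inv (P x)) ⟨
    (Q x ⊗ a) ⊗ inv (P x)     ≡⟨ cong (_⊗ inv (P x)) Q⊗α^≡P ⟩
    P x ⊗ inv (P x)           ≡⟨ ⊗-inverseʳ (P x) (norm-P≢0 x) ⟩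
    1q                        ∎

α⊘β^[1+n]≢1 : ∀ n → ¬ (α ⊘ β) ^ℕ suc n ≡ 1q
α⊘β^[1+n]≢1 n A^≡1 = [ ±1≢0 , uIm≢0 ]′ (ℤP.i*j≡0⇒i≡0∨j≡0 (-[1+ 0 ] ℤ.^ k) im≡0)
  where
  open ≡-Reasoning
  k = suc n
  ±1≢0 : ¬ -[1+ 0 ] ℤ.^ k ≡ + 0
  ±1≢0 eq = contradiction (ℤP.i^n≡0⇒i≡0 -[1+ 0 ] k eq) λ ()
  uIm≢0 : ¬ + uIm (2 ℕ.* k) ≡ + 0
  uIm≢0 = uIm[1+n]≢0 (ℕ.pred (2 ℕ.* k)) ∘ ℤP.+-injective
  W^≡ : W ^₅ k ≡ sc (-[1+ 0 ] ℤ.^ k) *₅ z5 (+ uRe (2 ℕ.* k)) (+ uIm (2 ℕ.* k))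
  W^≡ = begin
    W ^₅ k                                                        ≡⟨ cong (_^₅ k) W≡-U² ⟩
    (sc -[1+ 0 ] *₅ U ^₅ 2) ^₅ k                                  ≡⟨ ^₅-distrib-*₅ (sc -[1+ 0 ]) (U ^₅ 2) k ⟩
    sc -[1+ 0 ] ^₅ k *₅ (U ^₅ 2) ^₅ k                             ≡⟨ cong₂ _*₅_ (sc-^₅ -[1+ 0 ] k) (trans (^₅-* U 2 k) (U^≡ (2 ℕ.* k))) ⟩
    sc (-[1+ 0 ] ℤ.^ k) *₅ z5 (+ uRe (2 ℕ.* k)) (+ uIm (2 ℕ.* k)) ∎
  W^*1≡2^ : W ^₅ k *₅ two ^₅ 0 ≡ 1₅ *₅ two ^₅ (2 ℕ.* k)
  W^*1≡2^ = dyadic-injective (2 ℕ.* k) 0 (W ^₅ k) 1₅ (trans (sym (α⊘β^≡dyadic k)) A^≡1)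
  im≡0 : -[1+ 0 ] ℤ.^ k ℤ.* + uIm (2 ℕ.* k) ≡ + 0
  im≡0 = begin
    -[1+ 0 ] ℤ.^ k ℤ.* + uIm (2 ℕ.* k)         ≡⟨ im₅-sc-*₅ (-[1+ 0 ] ℤ.^ k) (z5 (+ uRe (2 ℕ.* k)) (+ uIm (2 ℕ.* k))) ⟨
    im₅ (sc (-[1+ 0 ] ℤ.^ k) *₅ z5 (+ uRe (2 ℕ.* k)) (+ uIm (2 ℕ.* k)))  ≡⟨ cong im₅ W^≡ ⟨
    im₅ (W ^₅ k)                                ≡⟨ cong im₅ (*₅-identityʳ (W ^₅ k)) ⟨
    im₅ (W ^₅ k *₅ two ^₅ 0)                    ≡⟨ cong im₅ W^*1≡2^ ⟩
    im₅ (1₅ *₅ two ^₅ (2 ℕ.* k))                ≡⟨ cong im₅ (trans (*₅-identityˡ (two ^₅ (2 ℕ.* k))) (⌜⌝-^₅ 2 (2 ℕ.* k))) ⟩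
    + 0                                         ∎

clear-G : ∀ x n a b → a ⊗ G x ^ℕ n ≡ b ⊗ 1q → a ⊗ Q x ^ℕ n ≡ b ⊗ P x ^ℕ n
clear-G x n a b rel = begin
  a ⊗ Q x ^ℕ n                  ≡⟨ cong (a ⊗_) G^⊗P^≡Q^ ⟨
  a ⊗ (G x ^ℕ n ⊗ P x ^ℕ n)     ≡⟨ ⊗-assoc a (G x ^ℕ n) (P x ^ℕ n) ⟨
  (a ⊗ G x ^ℕ n) ⊗ P x ^ℕ n     ≡⟨ cong (_⊗ P x ^ℕ n) (trans rel (⊗-identityʳ b)) ⟩
  b ⊗ P x ^ℕ n                  ∎
  where
  open ≡-Reasoning
  G^⊗P^≡Q^ : G x ^ℕ n ⊗ P x ^ℕ n ≡ Q x ^ℕ n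
  G^⊗P^≡Q^ = trans (sym (^ℕ-distrib-⊗ (G x) (P x) n)) (cong (_^ℕ n) (G⊗P≡Q x))

module OddExponent (m : ℕ) (5≤x : 5 ≤ 1 ℕ.+ 2 ℕ.* m) where
  open import Data.Nat using (_+_; _*_; _^_)

  x E t : ℕ
  x = 1 + 2 * m
  E = uRe x
  t = 2 ^ x

  μ : ℤ√5
  μ = ⌜ 2 * t ⌝

  V*cjV≡E*μ : V x *₅ cj (V x) ≡ ⌜ E ⌝ *₅ μ
  V*cjV≡E*μ = begin
    V x *₅ cj (V x)                 ≡⟨ *₅-cj (V x) ⟩
    sc (N (V x))                    ≡⟨ cong sc (N-V-odd m) ⟩
    sc (+ 2 ℤ.* (+ t ℤ.* + E))      ≡⟨ cong sc (trans (reorder (+ t) (+ E)) (cong (ℤ._*_ (+ E)) (sym (ℤP.pos-* 2 t)))) ⟩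
    sc (+ E ℤ.* + (2 * t))        ≡⟨ sc-*₅ (+ E) (+ (2 * t)) ⟨
    ⌜ E ⌝ *₅ μ                      ∎
    where
    open ≡-Reasoning
    reorder : ∀ t e → + 2 ℤ.* (t ℤ.* e) ≡ e ℤ.* (+ 2 ℤ.* t)
    reorder = ℤ-Tactic.solve-∀

  re-V : re₅ (V x) ≡ + (E + t)
  re-V = trans (cong₂ ℤ._+_ (cong re₅ (U^≡ x)) (cong re₅ (⌜⌝-^₅ 2 x))) (sym (ℤP.pos-+ E t))

  2*re-V : sc (+ 2 ℤ.* re₅ (V x)) ≡ μ +₅ ⌜ E ⌝ *₅ two
  2*re-V = begin
    sc (+ 2 ℤ.* re₅ (V x))              ≡⟨ cong (λ r → sc (+ 2 ℤ.* r)) re-V ⟩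
    sc (+ 2 ℤ.* + (E + t))            ≡⟨ cong sc (ℤP.pos-* 2 (E + t)) ⟨
    sc (+ (2 * (E + t)))            ≡⟨ cong (sc ∘ +_) (distribute E t) ⟩
    sc (+ (2 * t + E * 2))        ≡⟨ cong sc (ℤP.pos-+ (2 * t) (E * 2)) ⟩
    μ +₅ ⌜ E * 2 ⌝                    ≡⟨ cong (μ +₅_) (⌜⌝-*₅ E 2) ⟨
    μ +₅ ⌜ E ⌝ *₅ two                   ∎
    where
    open ≡-Reasoning
    distribute : ∀ e t → 2 * (e + t) ≡ 2 * t + e * 2
    distribute = ℕ-Tactic.solve-∀

  V*cjV≈0 : V x *₅ cj (V x) ≈ 0₅ [mod ⌜ E ⌝ ]
  V*cjV≈0 = subst (_≈ 0₅ [mod ⌜ E ⌝ ]) (sym V*cjV≡E*μ) (*≈0[mod] ⌜ E ⌝ μ)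

  V*V≈μ*V : V x *₅ V x ≈ μ *₅ V x [mod ⌜ E ⌝ ]
  V*V≈μ*V = μ , two *₅ V x , (begin
    V x *₅ V x +₅ ⌜ E ⌝ *₅ μ             ≡⟨ cong (V x *₅ V x +₅_) (trans (sym V*cjV≡E*μ) (*₅-cj (V x))) ⟩
    V x *₅ V x +₅ sc (N (V x))           ≡⟨ cayley-hamilton (V x) ⟩
    sc (+ 2 ℤ.* re₅ (V x)) *₅ V x        ≡⟨ cong (_*₅ V x) 2*re-V ⟩
    (μ +₅ ⌜ E ⌝ *₅ two) *₅ V x           ≡⟨ *₅-distribʳ (V x) μ (⌜ E ⌝ *₅ two) ⟩
    μ *₅ V x +₅ ⌜ E ⌝ *₅ two *₅ V x      ≡⟨ cong (μ *₅ V x +₅_) (*₅-assoc ⌜ E ⌝ two (V x)) ⟩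
    μ *₅ V x +₅ ⌜ E ⌝ *₅ (two *₅ V x)    ∎)
    where open ≡-Reasoning

  relation⇒ℤ√5 : ∀ p q n → (α ⊘ β) ^ℕ p ⊗ Q x ^ℕ n ≡ (α ⊘ β) ^ℕ q ⊗ P x ^ℕ n →
                 W ^₅ p *₅ two ^₅ (2 * q + x * n) *₅ cj (V x) ^₅ n
                   ≡ W ^₅ q *₅ two ^₅ (2 * p + x * n) *₅ V x ^₅ n
  relation⇒ℤ√5 p q n rel = begin
    W ^₅ p *₅ two ^₅ a *₅ cj (V x) ^₅ n      ≡⟨ *₅-xy∙z≈xz∙y (W ^₅ p) (two ^₅ a) (cj (V x) ^₅ n) ⟩
    W ^₅ p *₅ cj (V x) ^₅ n *₅ two ^₅ a      ≡⟨ dyadic-injective b a (W ^₅ p *₅ cj (V x) ^₅ n) (W ^₅ q *₅ V x ^₅ n) rel-dyadic ⟩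
    W ^₅ q *₅ V x ^₅ n *₅ two ^₅ b           ≡⟨ *₅-xy∙z≈xz∙y (W ^₅ q) (V x ^₅ n) (two ^₅ b) ⟩
    W ^₅ q *₅ two ^₅ b *₅ V x ^₅ n           ∎
    where
    open ≡-Reasoning
    a = 2 * q + x * n
    b = 2 * p + x * n
    power-dyadic : ∀ p z → (α ⊘ β) ^ℕ p ⊗ dyadic x z ^ℕ n ≡ dyadic (2 * p + x * n) (W ^₅ p *₅ z ^₅ n)
    power-dyadic p z = trans (cong₂ _⊗_ (α⊘β^≡dyadic p) (dyadic-^ x z n)) (dyadic-⊗ (2 * p) (x * n) (W ^₅ p) (z ^₅ n))
    rel-dyadic : dyadic b (W ^₅ p *₅ cj (V x) ^₅ n) ≡ dyadic a (W ^₅ q *₅ V x ^₅ n)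
    rel-dyadic = begin
      dyadic b (W ^₅ p *₅ cj (V x) ^₅ n)       ≡⟨ power-dyadic p (cj (V x)) ⟨
      (α ⊘ β) ^ℕ p ⊗ dyadic x (cj (V x)) ^ℕ n ≡⟨ cong (λ y → (α ⊘ β) ^ℕ p ⊗ y ^ℕ n) (Q≡dyadic x) ⟨
      (α ⊘ β) ^ℕ p ⊗ Q x ^ℕ n                 ≡⟨ rel ⟩
      (α ⊘ β) ^ℕ q ⊗ P x ^ℕ n                 ≡⟨ cong (λ y → (α ⊘ β) ^ℕ q ⊗ y ^ℕ n) (P≡dyadic x) ⟩
      (α ⊘ β) ^ℕ q ⊗ dyadic x (V x) ^ℕ n      ≡⟨ power-dyadic q (V x) ⟩
      dyadic a (W ^₅ q *₅ V x ^₅ n)           ∎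

  cjW^*≡⌜⌝* : ∀ q b n → cj W ^₅ q *₅ (W ^₅ q *₅ two ^₅ b *₅ μ ^₅ n *₅ V x)
                        ≡ ⌜ 16 ^ q * 2 ^ b * (2 * t) ^ n ⌝ *₅ V x
  cjW^*≡⌜⌝* q b n = begin
    cj W ^₅ q *₅ (W ^₅ q *₅ two ^₅ b *₅ μ ^₅ n *₅ V x)   ≡⟨ *₅-assoc (cj W ^₅ q) (W ^₅ q *₅ two ^₅ b *₅ μ ^₅ n) (V x) ⟨
    cj W ^₅ q *₅ (W ^₅ q *₅ two ^₅ b *₅ μ ^₅ n) *₅ V x   ≡⟨ cong (_*₅ V x) (trans regroup scalars) ⟩
    ⌜ 16 ^ q * 2 ^ b * (2 * t) ^ n ⌝ *₅ V x              ∎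
    where
    open ≡-Reasoning
    regroup : cj W ^₅ q *₅ (W ^₅ q *₅ two ^₅ b *₅ μ ^₅ n) ≡ (cj W *₅ W) ^₅ q *₅ two ^₅ b *₅ μ ^₅ n
    regroup = begin
      cj W ^₅ q *₅ (W ^₅ q *₅ two ^₅ b *₅ μ ^₅ n)  ≡⟨ *₅-assoc (cj W ^₅ q) (W ^₅ q *₅ two ^₅ b) (μ ^₅ n) ⟨
      cj W ^₅ q *₅ (W ^₅ q *₅ two ^₅ b) *₅ μ ^₅ n  ≡⟨ cong (_*₅ μ ^₅ n) (*₅-assoc (cj W ^₅ q) (W ^₅ q) (two ^₅ b)) ⟨
      cj W ^₅ q *₅ W ^₅ q *₅ two ^₅ b *₅ μ ^₅ n    ≡⟨ cong (λ w → w *₅ two ^₅ b *₅ μ ^₅ n) (^₅-distrib-*₅ (cj W) W q) ⟨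
      (cj W *₅ W) ^₅ q *₅ two ^₅ b *₅ μ ^₅ n       ∎
    scalars : (cj W *₅ W) ^₅ q *₅ two ^₅ b *₅ μ ^₅ n ≡ ⌜ 16 ^ q * 2 ^ b * (2 * t) ^ n ⌝
    scalars = begin
      (cj W *₅ W) ^₅ q *₅ two ^₅ b *₅ μ ^₅ n       ≡⟨ cong (λ w → w ^₅ q *₅ two ^₅ b *₅ μ ^₅ n) cjW*W≡16 ⟩
      ⌜ 16 ⌝ ^₅ q *₅ two ^₅ b *₅ μ ^₅ n            ≡⟨ cong₂ _*₅_ (cong₂ _*₅_ (⌜⌝-^₅ 16 q) (⌜⌝-^₅ 2 b)) (⌜⌝-^₅ (2 * t) n) ⟩
      ⌜ 16 ^ q ⌝ *₅ ⌜ 2 ^ b ⌝ *₅ ⌜ (2 * t) ^ n ⌝   ≡⟨ cong (_*₅ ⌜ (2 * t) ^ n ⌝) (⌜⌝-*₅ (16 ^ q) (2 ^ b)) ⟩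
      ⌜ 16 ^ q * 2 ^ b ⌝ *₅ ⌜ (2 * t) ^ n ⌝        ≡⟨ ⌜⌝-*₅ (16 ^ q * 2 ^ b) ((2 * t) ^ n) ⟩
      ⌜ 16 ^ q * 2 ^ b * (2 * t) ^ n ⌝             ∎

  noRelation : ∀ p q l → ¬ (α ⊘ β) ^ℕ p ⊗ Q x ^ℕ suc l ≡ (α ⊘ β) ^ℕ q ⊗ P x ^ℕ suc l
  noRelation p q l rel = uRe∤powerOf2 5≤x (isPowerOf2-* C-isPowerOf2 (x , refl)) E∣C*t
    where
    a b C : ℕ
    a = 2 * q + x * suc l
    b = 2 * p + x * suc l
    C = 16 ^ q * 2 ^ b * (2 * t) ^ suc l
    C-isPowerOf2 : IsPowerOf2 C
    C-isPowerOf2 =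
      isPowerOf2-* (isPowerOf2-* (isPowerOf2-^ (4 , refl) q) (b , refl)) (isPowerOf2-^ (suc x , refl) (suc l))
    ≈0 : W ^₅ q *₅ two ^₅ b *₅ μ ^₅ suc l *₅ V x ≈ 0₅ [mod ⌜ E ⌝ ]
    ≈0 = powerRelation⇒≈0[mod] {⌜ E ⌝} {V x} {cj (V x)} {μ} (W ^₅ p *₅ two ^₅ a) (W ^₅ q *₅ two ^₅ b) l
           V*cjV≈0 V*V≈μ*V (relation⇒ℤ√5 p q (suc l) rel)
    C*V≈0 : ⌜ C ⌝ *₅ V x ≈ 0₅ [mod ⌜ E ⌝ ]
    C*V≈0 = subst₂ _≈_[mod ⌜ E ⌝ ] (cjW^*≡⌜⌝* q b (suc l)) (*₅-zeroʳ (cj W ^₅ q))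
              (≈[mod]-*-congˡ {⌜ E ⌝} (cj W ^₅ q) ≈0)
    E∣C*[E+t] : E ∣ C * E + C * t
    E∣C*[E+t] = subst (E ∣_) (trans (cong (λ r → C * ℤ.∣ r ∣) re-V) (ℕP.*-distribˡ-+ C E t))
                  (⌜⌝*≈0[mod]⇒∣ C E (V x) C*V≈0)
    E∣C*t : E ∣ C * t
    E∣C*t = ∣m+n∣m⇒∣n E∣C*[E+t] (n∣m*n C)

  independent : ¬ MultDep (α ⊘ β) (G x)
  independent (k , l , k,l≢0 , rel) =
    go k l k,l≢0 (^ℤ-relation⇒^ℕ-relation (α ⊘ β) (G x) norm-α⊘β≢0 (norm-G≢0 x) k l rel)
    where
    A = α ⊘ β
    go : ∀ k l → ¬ (k ≡ + 0 × l ≡ + 0) → A ^ℕ pos k ⊗ G x ^ℕ pos l ≡ A ^ℕ neg k ⊗ G x ^ℕ neg l → ⊥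
    go (+ zero)  (+ zero)  k,l≢0 _   = k,l≢0 (refl , refl)
    go (+ suc n) (+ zero)  _     rel = α⊘β^[1+n]≢1 n (trans (sym (⊗-identityʳ (A ^ℕ suc n))) rel)
    go -[1+ n ]  (+ zero)  _     rel = α⊘β^[1+n]≢1 n (sym (trans rel (⊗-identityʳ (A ^ℕ suc n))))
    go k         (+ suc l) _     rel = noRelation (pos k) (neg k) l (clear-G x (suc l) (A ^ℕ pos k) (A ^ℕ neg k) rel)
    go k         -[1+ l ]  _     rel = noRelation (neg k) (pos k) l (clear-G x (suc l) (A ^ℕ neg k) (A ^ℕ pos k) (sym rel))

lemma4 : (x : ℕ) → 1 ≤ x →
    MultDep (α ⊘ β) (((β ^ℕ x) ⊕ 1q) ⊘ ((α ^ℕ x) ⊕ 1q))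
      ⇔ (x ≡ 1 ⊎ x ≡ 3 ⊎ 2 ∣ x)
lemma4 x _ = mk⇔ (dependent⇒ x) (⇒dependent x)
  where
  dependent⇒ : ∀ x → MultDep (α ⊘ β) (G x) → x ≡ 1 ⊎ x ≡ 3 ⊎ 2 ∣ x
  dependent⇒ x dep with parity x
  ... | even m            = inj₂ (inj₂ (divides m (ℕP.*-comm 2 m)))
  ... | odd 0             = inj₁ refl
  ... | odd 1             = inj₂ (inj₁ refl)
  ... | odd (suc (suc m)) =
    contradiction dep (OddExponent.independent (suc (suc m)) (ℕ.s≤s (ℕP.*-monoʳ-≤ 2 (ℕP.m≤m+n 2 m))))
  ⇒dependent : ∀ x → x ≡ 1 ⊎ x ≡ 3 ⊎ 2 ∣ x → MultDep (α ⊘ β) (G x)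
  ⇒dependent _ (inj₁ refl)                     = + 2 , + 1 , (λ ()) , refl
  ⇒dependent _ (inj₂ (inj₁ refl))              = + 2 , + 1 , (λ ()) , refl
  ⇒dependent _ (inj₂ (inj₂ (divides m refl)))  =
    subst (λ y → MultDep (α ⊘ β) (G y)) (ℕP.*-comm 2 m) (even⇒dependent m)
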